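{- Let $k\ge1$, $n=2k$, and let $a_1,\dots,a_n$ be positive integers with $\max_i a_i/\min_i a_i\le1+\frac1{100k}$ such that some $\mathcal{I}\subseteq[n]$ with $|\mathcal{I}|=k$ satisfies $\sum_{i\in\mathcal{I}}a_i=\frac12\sum_{i=1}^n a_i$. Let $(\mathcal{D},f)$ be the instance constructed from $(a_1,\dots,a_n)$ as described in the context. Then $\mathsf{CalDist}_{\mathcal{D}}(f)\le\frac{1}{36k}$.
   Context: Construction: let $S=\sum_{i=1}^n a_i$, $\epsilon_i=a_i/S$, $\epsilon=\frac1{6k}$, $\delta=\frac1{4k}$. The domain is $\mathcal{X}=\{x_1,\dots,x_n\}\cup\{x'_1,\dots,x'_n\}\cup\{x''_1,\dots,x''_n\}$ ($3n$ distinct elements); $\mathcal{D}$ over $\mathcal{X}\times\{0,1\}$ has uniform $\mathcal{X}$-marginal and conditional probabilities $\mu(x)=\Pr[y=1\mid x]$ given by $\mu(x_i)=\frac12+\epsilon_i$, $\mu(x'_i)=\frac12-\delta$, $\mu(x''_i)=\frac12$; the predictor is $f(x_i)=f(x'_i)=\frac12$, $f(x''_i)=\frac12+\epsilon$. For a distribution $\mathcal{D}$ with marginal $\mathcal{D}_x$: $g:\mathcal{X}\to[0,1]$ is perfectly calibrated if for every $\alpha$ with $\Pr[g(x)=\alpha]>0$, $\Pr[y=1\mid g(x)=\alpha]=\alpha$; $\mathcal{C}(\mathcal{D})$ is the set of such $g$; $d_{\mathcal{D}}(f,g)=\mathbb{E}_{x\sim\mathcal{D}_x}|f(x)-g(x)|$;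 $\mathsf{CalDist}_{\mathcal{D}}(f)=\inf_{g\in\mathcal{C}(\mathcal{D})}d_{\mathcal{D}}(f,g)$. -}

module Defs where

open import Data.Nat as ℕ using (ℕ; zero; suc)
open import Data.Integer using (+_)
open import Data.Rational using (ℚ; 0ℚ; 1ℚ; ½; _+_; _-_; _*_; _≤_; _<_; ∣_∣; _/_)
open import Data.Rational.Properties using (_≟_)
open import Data.Fin using (Fin; zero; suc)
open import Data.Fin.Subset using (Subset; _∈_)
open import Data.Vec using (lookup)
open import Data.Bool using (Bool; true; false; if_then_else_)
open import Data.Product using (_×_; _,_; ∃)
open import Relation.Nullary using (does)
open import Relation.Binary.PropositionalEquality using (_≡_)

-- p / q as a rational, with the (never used here) convention p / 0 = 0.
frac : ℕ → ℕ → ℚ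
frac p zero    = 0ℚ
frac p (suc q) = (+ p) / suc q

sumℕ : (n : ℕ) → (Fin n → ℕ) → ℕ
sumℕ zero    h = 0
sumℕ (suc n) h = h zero ℕ.+ sumℕ n (λ i → h (suc i))

sumOn : (n : ℕ) → Subset n → (Fin n → ℕ) → ℕ
sumOn n I a = sumℕ n (λ i → if lookup I i then a i else 0)

sumℚ : (n : ℕ) → (Fin n → ℚ) → ℚ
sumℚ zero    h = 0ℚ
sumℚ (suc n) h = h zero + sumℚ n (λ i → h (suc i))

data Kind : Set where
  X X′ X″ : Kind

-- domain 𝒳 = {x_i} ∪ {x'_i} ∪ {x''_i}, 3n distinct elements
Pt : ℕ → Set
Pt n = Kind × Fin n

sumPt : (n : ℕ) → (Pt n → ℚ) → ℚ
sumPt n h = sumℚ n (λ i → h (X , i)) + (sumℚ n (λ i → h (X′ , i)) + sumℚ n (λ i → h (X″ , i)))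

S : (n : ℕ) → (Fin n → ℕ) → ℕ
S n a = sumℕ n a

-- μ(x) = Pr[y = 1 | x] for the instance built from k and a (n = 2k)
μ : (k : ℕ) → (Fin (2 ℕ.* k) → ℕ) → Pt (2 ℕ.* k) → ℚ
μ k a (X  , i) = ½ + frac (a i) (S (2 ℕ.* k) a)
μ k a (X′ , i) = ½ - frac 1 (4 ℕ.* k)
μ k a (X″ , i) = ½

fPred : (k : ℕ) → Pt (2 ℕ.* k) → ℚ
fPred k (X  , i) = ½
fPred k (X′ , i) = ½
fPred k (X″ , i) = ½ + frac 1 (6 ℕ.* k)

sameLevel : {n : ℕ} → (Pt n → ℚ) → Pt n → Pt n → Bool
sameLevel g p q = does (g q ≟ g p)

-- g is perfectly calibrated w.r.t. 𝒟 (uniform marginal on the 3n points,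
-- so every value taken by g has positive probability):
-- for every value α = g p,  Pr[y=1 | g(x)=α] = α, i.e.
--   Σ_{q : g q = α} μ(q) = α · #{q : g q = α}
-- (the common factor 1/(3n) of the uniform marginal cancels).
PerfectlyCalibrated : (k : ℕ) → (Fin (2 ℕ.* k) → ℕ) → (Pt (2 ℕ.* k) → ℚ) → Set
PerfectlyCalibrated k a g =
  (∀ p → (0ℚ ≤ g p) × (g p ≤ 1ℚ)) ×
  (∀ p → sumPt (2 ℕ.* k) (λ q → if sameLevel g p q then μ k a q else 0ℚ)
         ≡ g p * sumPt (2 ℕ.* k) (λ q → if sameLevel g p q then 1ℚ else 0ℚ))

dist : (k : ℕ) → (Pt (2 ℕ.* k) → ℚ) → (Pt (2 ℕ.* k) → ℚ) → ℚ
dist k f g = frac 1 (3 ℕ.* (2 ℕ.* k)) * sumPt (2 ℕ.* k) (λ q → ∣ f q - g q ∣)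

-- CalDist_𝒟(f) ≤ c, unfolding the infimum: for every η > 0 there is a
-- perfectly calibrated g with d_𝒟(f,g) ≤ c + η.
CalDistLE : (k : ℕ) → (Fin (2 ℕ.* k) → ℕ) → ℚ → Set
CalDistLE k a c =
  ∀ (η : ℚ) → 0ℚ < η →
    ∃ λ (g : Pt (2 ℕ.* k) → ℚ) → PerfectlyCalibrated k a g × (dist k (fPred k) g ≤ c + η)

{-# OPTIONS --safe #-}
-- Take g = ½ + ε on {x_i : i ∈ I} ∪ {x''_i} and g = ½ on {x_i : i ∉ I} ∪ {x'_i}.
-- On the upper level set the excess of μ over ½ + ε is Σ_{i∈I} ε_i − 3kε = ½ − ½ = 0,
-- and on the lower one the excess over ½ is Σ_{i∉I} ε_i − 2kδ = ½ − ½ = 0, since I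
-- carries exactly half of S. So g is perfectly calibrated, and it differs from f
-- only on the k points x_i with i ∈ I, each by ε; hence d(f, g) = kε / 6k = 1/36k.
module Submission where

open import Defs
open import Data.Bool using (Bool; true; false; if_then_else_; not)
open import Data.Fin using (Fin; zero; suc)
open import Data.Fin.Subset as Subset using (Subset)
open import Data.Nat as ℕ using (ℕ; zero; suc)
import Data.Nat.Properties as ℕ
open import Data.Product using (_×_; _,_)
open import Function using (_∘_)
open import Relation.Binary.PropositionalEquality
  using (_≡_; _≢_; refl; sym; trans; cong; cong₂; module ≡-Reasoning)

module Fractions where

  import Data.Integer as ℤ
  import Data.Integer.Properties as ℤ
  open import Data.Rational using (ℚ; 0ℚ; 1ℚ; ½; _+_; _-_; _*_; _≤_; fromℚᵘ; toℚᵘ)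
  open import Data.Rational.Properties
  open import Data.Rational.Unnormalised as ℚᵘ using (mkℚᵘ; *≡*)
  import Data.Rational.Unnormalised.Properties as ℚᵘ
  open import Level using (0ℓ)
  open import Relation.Nullary.Decidable using (dec⇒maybe)
  open import Tactic.RingSolver using (solve-∀)
  import Tactic.RingSolver.Core.AlmostCommutativeRing as ACR

  open ≡-Reasoning

  ℚ-ring : ACR.AlmostCommutativeRing 0ℓ 0ℓ
  ℚ-ring = ACR.fromCommutativeRing +-*-commutativeRing (λ p → dec⇒maybe (0ℚ ≟ p))

  fromℚᵘ-homo-+ : ∀ p q → fromℚᵘ (p ℚᵘ.+ q) ≡ fromℚᵘ p + fromℚᵘ q
  fromℚᵘ-homo-+ p q = begin
    fromℚᵘ (p ℚᵘ.+ q)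
      ≡⟨ fromℚᵘ-cong (ℚᵘ.+-cong (ℚᵘ.≃-sym (toℚᵘ-fromℚᵘ p)) (ℚᵘ.≃-sym (toℚᵘ-fromℚᵘ q))) ⟩
    fromℚᵘ (toℚᵘ (fromℚᵘ p) ℚᵘ.+ toℚᵘ (fromℚᵘ q))
      ≡⟨ fromℚᵘ-cong (ℚᵘ.≃-sym (toℚᵘ-homo-+ (fromℚᵘ p) (fromℚᵘ q))) ⟩
    fromℚᵘ (toℚᵘ (fromℚᵘ p + fromℚᵘ q))
      ≡⟨ fromℚᵘ-toℚᵘ _ ⟩
    fromℚᵘ p + fromℚᵘ q
      ∎

  fromℚᵘ-homo-* : ∀ p q → fromℚᵘ (p ℚᵘ.* q) ≡ fromℚᵘ p * fromℚᵘ q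
  fromℚᵘ-homo-* p q = begin
    fromℚᵘ (p ℚᵘ.* q)
      ≡⟨ fromℚᵘ-cong (ℚᵘ.*-cong (ℚᵘ.≃-sym (toℚᵘ-fromℚᵘ p)) (ℚᵘ.≃-sym (toℚᵘ-fromℚᵘ q))) ⟩
    fromℚᵘ (toℚᵘ (fromℚᵘ p) ℚᵘ.* toℚᵘ (fromℚᵘ q))
      ≡⟨ fromℚᵘ-cong (ℚᵘ.≃-sym (toℚᵘ-homo-* (fromℚᵘ p) (fromℚᵘ q))) ⟩
    fromℚᵘ (toℚᵘ (fromℚᵘ p * fromℚᵘ q))
      ≡⟨ fromℚᵘ-toℚᵘ _ ⟩
    fromℚᵘ p * fromℚᵘ q
      ∎

  fromℕ : ℕ → ℚ
  fromℕ n = frac n 1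

  fromℕ-+ : ∀ m n → fromℕ (m ℕ.+ n) ≡ fromℕ m + fromℕ n
  fromℕ-+ m n =
    trans (fromℚᵘ-cong {mkℚᵘ (ℤ.+ (m ℕ.+ n)) 0} {mkℚᵘ (ℤ.+ m) 0 ℚᵘ.+ mkℚᵘ (ℤ.+ n) 0} (*≡* eq))
          (fromℚᵘ-homo-+ (mkℚᵘ (ℤ.+ m) 0) (mkℚᵘ (ℤ.+ n) 0))
    where
    eq : ℤ.+ (m ℕ.+ n) ℤ.* ℤ.+ 1 ≡ (ℤ.+ m ℤ.* ℤ.+ 1 ℤ.+ ℤ.+ n ℤ.* ℤ.+ 1) ℤ.* ℤ.+ 1
    eq = cong (ℤ._* ℤ.+ 1)
              (trans (ℤ.pos-+ m n) (sym (cong₂ ℤ._+_ (ℤ.*-identityʳ (ℤ.+ m)) (ℤ.*-identityʳ (ℤ.+ n)))))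

  fromℕ-* : ∀ m n → fromℕ (m ℕ.* n) ≡ fromℕ m * fromℕ n
  fromℕ-* m n =
    trans (fromℚᵘ-cong {mkℚᵘ (ℤ.+ (m ℕ.* n)) 0} {mkℚᵘ (ℤ.+ m) 0 ℚᵘ.* mkℚᵘ (ℤ.+ n) 0} (*≡* eq))
          (fromℚᵘ-homo-* (mkℚᵘ (ℤ.+ m) 0) (mkℚᵘ (ℤ.+ n) 0))
    where
    eq : ℤ.+ (m ℕ.* n) ℤ.* ℤ.+ 1 ≡ (ℤ.+ m ℤ.* ℤ.+ n) ℤ.* ℤ.+ 1
    eq = cong (ℤ._* ℤ.+ 1) (ℤ.pos-* m n)

  frac≡fromℕ*frac1 : ∀ p q → frac p q ≡ fromℕ p * frac 1 q
  frac≡fromℕ*frac1 p zero    = sym (*-zeroʳ (fromℕ p))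
  frac≡fromℕ*frac1 p (suc q) =
    trans (fromℚᵘ-cong {mkℚᵘ (ℤ.+ p) q} {mkℚᵘ (ℤ.+ p) 0 ℚᵘ.* mkℚᵘ (ℤ.+ 1) q} (*≡* eq))
          (fromℚᵘ-homo-* (mkℚᵘ (ℤ.+ p) 0) (mkℚᵘ (ℤ.+ 1) q))
    where
    eq : ℤ.+ p ℤ.* ℤ.+ suc (q ℕ.+ 0) ≡ (ℤ.+ p ℤ.* ℤ.+ 1) ℤ.* ℤ.+ suc q
    eq = cong₂ ℤ._*_ (sym (ℤ.*-identityʳ (ℤ.+ p))) (cong (λ d → ℤ.+ suc d) (ℕ.+-identityʳ q))

  frac1*fromℕ≡1 : ∀ q .{{_ : ℕ.NonZero q}} → frac 1 q * fromℕ q ≡ 1ℚ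
  frac1*fromℕ≡1 (suc q) =
    trans (sym (fromℚᵘ-homo-* (mkℚᵘ (ℤ.+ 1) q) (mkℚᵘ (ℤ.+ suc q) 0)))
          (fromℚᵘ-cong {mkℚᵘ (ℤ.+ 1) q ℚᵘ.* mkℚᵘ (ℤ.+ suc q) 0} {mkℚᵘ (ℤ.+ 1) 0} (*≡* eq))
    where
    eq : (ℤ.+ 1 ℤ.* ℤ.+ suc q) ℤ.* ℤ.+ 1 ≡ ℤ.+ 1 ℤ.* ℤ.+ suc (q ℕ.* 1)
    eq = trans (ℤ.*-identityʳ _) (cong (λ d → ℤ.+ 1 ℤ.* ℤ.+ suc d) (sym (ℕ.*-identityʳ q)))

  frac1-unique : ∀ {x} q .{{_ : ℕ.NonZero q}} → x * fromℕ q ≡ 1ℚ → x ≡ frac 1 q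
  frac1-unique {x} q x*q≡1 = begin
    x                              ≡⟨ sym (*-identityʳ x) ⟩
    x * 1ℚ                         ≡⟨ cong (x *_) (sym (frac1*fromℕ≡1 q)) ⟩
    x * (frac 1 q * fromℕ q)       ≡⟨ cong (x *_) (*-comm (frac 1 q) (fromℕ q)) ⟩
    x * (fromℕ q * frac 1 q)       ≡⟨ sym (*-assoc x (fromℕ q) (frac 1 q)) ⟩
    x * fromℕ q * frac 1 q         ≡⟨ cong (_* frac 1 q) x*q≡1 ⟩
    1ℚ * frac 1 q                  ≡⟨ *-identityˡ (frac 1 q) ⟩
    frac 1 q                       ∎

  frac-+ : ∀ p p′ q → frac (p ℕ.+ p′) q ≡ frac p q + frac p′ q
  frac-+ p p′ q = begin
    frac (p ℕ.+ p′) q                        ≡⟨ frac≡fromℕ*frac1 (p ℕ.+ p′) q ⟩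
    fromℕ (p ℕ.+ p′) * frac 1 q              ≡⟨ cong (_* frac 1 q) (fromℕ-+ p p′) ⟩
    (fromℕ p + fromℕ p′) * frac 1 q          ≡⟨ *-distribʳ-+ (frac 1 q) (fromℕ p) (fromℕ p′) ⟩
    fromℕ p * frac 1 q + fromℕ p′ * frac 1 q ≡⟨ cong₂ _+_ (frac≡fromℕ*frac1 p q) (frac≡fromℕ*frac1 p′ q) ⟨
    frac p q + frac p′ q                     ∎

  frac0≡0 : ∀ q → frac 0 q ≡ 0ℚ
  frac0≡0 q = trans (frac≡fromℕ*frac1 0 q) (*-zeroˡ (frac 1 q))

  frac-self : ∀ q .{{_ : ℕ.NonZero q}} → frac q q ≡ 1ℚ
  frac-self q = trans (frac≡fromℕ*frac1 q q) (trans (*-comm (fromℕ q) (frac 1 q)) (frac1*fromℕ≡1 q))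

  frac-half : ∀ p q .{{_ : ℕ.NonZero q}} → 2 ℕ.* p ≡ q → frac p q ≡ ½
  frac-half p q 2p≡q = begin
    frac p q                             ≡⟨ frac≡fromℕ*frac1 p q ⟩
    fromℕ p * frac 1 q                   ≡⟨ halve (fromℕ p) (frac 1 q) ⟩
    ½ * (fromℕ 2 * fromℕ p * frac 1 q)   ≡⟨ cong (λ x → ½ * (x * frac 1 q)) (sym (fromℕ-* 2 p)) ⟩
    ½ * (fromℕ (2 ℕ.* p) * frac 1 q)     ≡⟨ cong (½ *_) (sym (frac≡fromℕ*frac1 (2 ℕ.* p) q)) ⟩
    ½ * frac (2 ℕ.* p) q                 ≡⟨ cong (λ m → ½ * frac m q) 2p≡q ⟩
    ½ * frac q q                         ≡⟨ cong (½ *_) (frac-self q) ⟩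
    ½ * 1ℚ                               ≡⟨ *-identityʳ ½ ⟩
    ½                                    ∎
    where
    halve : ∀ x y → x * y ≡ ½ * (fromℕ 2 * x * y)
    halve = solve-∀ ℚ-ring

  0≤frac : ∀ p q → 0ℚ ≤ frac p q
  0≤frac p zero    = ≤-refl
  0≤frac p (suc q) = nonNegative⁻¹ _ {{normalize-nonNeg p (suc q)}}

  frac1≤½ : ∀ {q} → 2 ℕ.≤ q → frac 1 q ≤ ½
  frac1≤½ {suc zero} (ℕ.s≤s ())
  frac1≤½ {suc (suc q)} _ =
    toℚᵘ-cancel-≤ (ℚᵘ.≤-respˡ-≃ (ℚᵘ.≃-sym (toℚᵘ-fromℚᵘ (mkℚᵘ (ℤ.+ 1) (suc q))))
                                (ℚᵘ.*≤* (ℤ.+≤+ (ℕ.s≤s (ℕ.s≤s ℕ.z≤n)))))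

  -- Lets the ring solver prove identities that hold only under the side condition e = 1.
  ≡-modulo : ∀ {x y} c {e} → e ≡ 1ℚ → x ≡ y + c * (1ℚ - e) → x ≡ y
  ≡-modulo {x} {y} c {e} e≡1 x≡y+c[1-e] = begin
    x                    ≡⟨ x≡y+c[1-e] ⟩
    y + c * (1ℚ - e)     ≡⟨ cong (λ t → y + c * (1ℚ - t)) e≡1 ⟩
    y + c * 0ℚ           ≡⟨ cong (y +_) (*-zeroʳ c) ⟩
    y + 0ℚ               ≡⟨ +-identityʳ y ⟩
    y                    ∎

module Sums where

  open Fractions
  open import Data.Rational using (ℚ; 0ℚ; 1ℚ; _+_; _*_)
  open import Data.Rational.Properties
    using (*-zeroˡ; *-zeroʳ; *-identityʳ; +-identityˡ; +-identityʳ; *-distribˡ-+)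
  open import Data.Fin.Subset using (∣_∣)
  open import Data.Vec using (lookup; []; _∷_)
  open import Tactic.RingSolver using (solve-∀)
  open ≡-Reasoning

  sumℚ-cong : ∀ n {f g : Fin n → ℚ} → (∀ i → f i ≡ g i) → sumℚ n f ≡ sumℚ n g
  sumℚ-cong zero    f≗g = refl
  sumℚ-cong (suc n) f≗g = cong₂ _+_ (f≗g zero) (sumℚ-cong n (λ i → f≗g (suc i)))

  sumℚ-+ : ∀ n (f g : Fin n → ℚ) → sumℚ n (λ i → f i + g i) ≡ sumℚ n f + sumℚ n g
  sumℚ-+ zero    f g = refl
  sumℚ-+ (suc n) f g = trans (cong ((f zero + g zero) +_) (sumℚ-+ n (λ i → f (suc i)) (λ i → g (suc i))))
                             (+-interchange (f zero) (g zero) _ _)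
    where
    +-interchange : ∀ a b c d → (a + b) + (c + d) ≡ (a + c) + (b + d)
    +-interchange = solve-∀ ℚ-ring

  sumℚ-*ˡ : ∀ n c (f : Fin n → ℚ) → sumℚ n (λ i → c * f i) ≡ c * sumℚ n f
  sumℚ-*ˡ zero    c f = sym (*-zeroʳ c)
  sumℚ-*ˡ (suc n) c f = trans (cong (c * f zero +_) (sumℚ-*ˡ n c (λ i → f (suc i))))
                              (sym (*-distribˡ-+ c (f zero) _))

  sumℚ-const : ∀ n c → sumℚ n (λ _ → c) ≡ fromℕ n * c
  sumℚ-const zero    c = sym (*-zeroˡ c)
  sumℚ-const (suc n) c = begin
    c + sumℚ n (λ _ → c)     ≡⟨ cong (c +_) (sumℚ-const n c) ⟩
    c + fromℕ n * c          ≡⟨ factor c (fromℕ n) ⟩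
    (1ℚ + fromℕ n) * c       ≡⟨ cong (_* c) (sym (fromℕ-+ 1 n)) ⟩
    fromℕ (suc n) * c        ∎
    where
    factor : ∀ c x → c + x * c ≡ (1ℚ + x) * c
    factor = solve-∀ ℚ-ring

  sumℚ-zero : ∀ n → sumℚ n (λ _ → 0ℚ) ≡ 0ℚ
  sumℚ-zero n = trans (sumℚ-const n 0ℚ) (*-zeroʳ (fromℕ n))

  sumℚ-frac : ∀ n (h : Fin n → ℕ) q → sumℚ n (λ i → frac (h i) q) ≡ frac (sumℕ n h) q
  sumℚ-frac zero    h q = sym (frac0≡0 q)
  sumℚ-frac (suc n) h q = trans (cong (frac (h zero) q +_) (sumℚ-frac n (λ i → h (suc i)) q))
                                (sym (frac-+ (h zero) (sumℕ n (λ i → h (suc i))) q))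

  if-+ : ∀ b x y → (if b then x + y else 0ℚ) ≡ (if b then x else 0ℚ) + (if b then y else 0ℚ)
  if-+ true  x y = refl
  if-+ false x y = refl

  if-scale : ∀ b c → (if b then c else 0ℚ) ≡ c * (if b then 1ℚ else 0ℚ)
  if-scale true  c = sym (*-identityʳ c)
  if-scale false c = sym (*-zeroʳ c)

  if-frac : ∀ b p q → (if b then frac p q else 0ℚ) ≡ frac (if b then p else 0) q
  if-frac true  p q = refl
  if-frac false p q = sym (frac0≡0 q)

  if-partition : ∀ b x → (if b then x else 0ℚ) + (if not b then x else 0ℚ) ≡ x
  if-partition true  x = +-identityʳ x
  if-partition false x = +-identityˡ x

  sumℚ-partition : ∀ n (b : Fin n → Bool) (f : Fin n → ℚ) →
    sumℚ n (λ i → if b i then f i else 0ℚ) + sumℚ n (λ i → if not (b i) then f i else 0ℚ) ≡ sumℚ n f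
  sumℚ-partition n b f = trans (sym (sumℚ-+ n _ _)) (sumℚ-cong n (λ i → if-partition (b i) (f i)))

  sumℚ-scale : ∀ n (b : Fin n → Bool) c →
    sumℚ n (λ i → if b i then c else 0ℚ) ≡ c * sumℚ n (λ i → if b i then 1ℚ else 0ℚ)
  sumℚ-scale n b c = trans (sumℚ-cong n (λ i → if-scale (b i) c)) (sumℚ-*ˡ n c _)

  sumℚ-count : ∀ {n} (I : Subset n) → sumℚ n (λ i → if lookup I i then 1ℚ else 0ℚ) ≡ fromℕ ∣ I ∣
  sumℚ-count []          = refl
  sumℚ-count (true ∷ I)  = trans (cong (1ℚ +_) (sumℚ-count I)) (sym (fromℕ-+ 1 ∣ I ∣))
  sumℚ-count (false ∷ I) = trans (+-identityˡ _) (sumℚ-count I)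

  sumPt-cong : ∀ n {f g : Pt n → ℚ} → (∀ x → f x ≡ g x) → sumPt n f ≡ sumPt n g
  sumPt-cong n f≗g = cong₂ _+_ (sumℚ-cong n (λ i → f≗g (X , i)))
                       (cong₂ _+_ (sumℚ-cong n (λ i → f≗g (X′ , i))) (sumℚ-cong n (λ i → f≗g (X″ , i))))

module Calibration where

  open Sums
  open import Data.Rational using (ℚ; 0ℚ; 1ℚ; _*_; _≤_)
  open import Data.Rational.Properties using (_≟_; ≤-trans; ≤-reflexive; +-identityʳ; +-monoʳ-≤; <⇒≤)
  open import Relation.Nullary.Decidable using (does; dec-true; dec-false)

  CalibratedOn : (k : ℕ) → (Fin (2 ℕ.* k) → ℕ) → (Pt (2 ℕ.* k) → Bool) → ℚ → Set
  CalibratedOn k a L α =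
    sumPt (2 ℕ.* k) (λ x → if L x then μ k a x else 0ℚ) ≡ α * sumPt (2 ℕ.* k) (λ x → if L x then 1ℚ else 0ℚ)

  sumPt-if-cong : ∀ n {L L′ : Pt n → Bool} (f : Pt n → ℚ) → (∀ x → L x ≡ L′ x) →
    sumPt n (λ x → if L x then f x else 0ℚ) ≡ sumPt n (λ x → if L′ x then f x else 0ℚ)
  sumPt-if-cong n f L≗L′ = sumPt-cong n (λ x → cong (if_then f x else 0ℚ) (L≗L′ x))

  CalibratedOn-cong : ∀ {k a L L′ α} → (∀ x → L x ≡ L′ x) → CalibratedOn k a L α → CalibratedOn k a L′ α
  CalibratedOn-cong {k} {a} {α = α} L≗L′ calibrated =
    trans (sym (sumPt-if-cong (2 ℕ.* k) (μ k a) L≗L′))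
          (trans calibrated (cong (α *_) (sumPt-if-cong (2 ℕ.* k) (λ _ → 1ℚ) L≗L′)))

  ≟-twoValued : ∀ {α β : ℚ} → α ≢ β → ∀ b c →
    does ((if c then α else β) ≟ (if b then α else β)) ≡ (if b then c else not c)
  ≟-twoValued {α} {β} α≢β true  true  = dec-true (α ≟ α) refl
  ≟-twoValued {α} {β} α≢β true  false = dec-false (β ≟ α) (α≢β ∘ sym)
  ≟-twoValued {α} {β} α≢β false true  = dec-false (α ≟ β) α≢β
  ≟-twoValued {α} {β} α≢β false false = dec-true (β ≟ β) refl

  twoValued-perfectlyCalibrated : ∀ k a (B : Pt (2 ℕ.* k) → Bool) {α β} → α ≢ β →
    0ℚ ≤ α × α ≤ 1ℚ → 0ℚ ≤ β × β ≤ 1ℚ →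
    CalibratedOn k a B α → CalibratedOn k a (not ∘ B) β →
    PerfectlyCalibrated k a (λ x → if B x then α else β)
  twoValued-perfectlyCalibrated k a B {α} {β} α≢β α-bounded β-bounded on-B on-¬B =
    (λ p → bounded (B p)) ,
    (λ p → CalibratedOn-cong {k} {a} {α = if B p then α else β}
                             (λ x → sym (≟-twoValued α≢β (B p) (B x))) (onLevel (B p)))
    where
    bounded : ∀ b → 0ℚ ≤ (if b then α else β) × (if b then α else β) ≤ 1ℚ
    bounded true  = α-bounded
    bounded false = β-bounded
    onLevel : ∀ b → CalibratedOn k a (λ x → if b then B x else not (B x)) (if b then α else β)
    onLevel true  = on-B
    onLevel false = on-¬B

  calDistLE-witness : ∀ k a {c} (g : Pt (2 ℕ.* k) → ℚ) →
    PerfectlyCalibrated k a g → dist k (fPred k) g ≡ c → CalDistLE k a c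
  calDistLE-witness k a {c} g calibrated dist≡c η η>0 =
    g , calibrated , ≤-trans (≤-reflexive (trans dist≡c (sym (+-identityʳ c)))) (+-monoʳ-≤ c (<⇒≤ η>0))

module Witness (k : ℕ) {{_ : ℕ.NonZero k}} (a : Fin (2 ℕ.* k) → ℕ) {{_ : ℕ.NonZero (S (2 ℕ.* k) a)}}
               (I : Subset (2 ℕ.* k)) (∣I∣≡k : Subset.∣ I ∣ ≡ k)
               (I-halves : 2 ℕ.* sumOn (2 ℕ.* k) I a ≡ S (2 ℕ.* k) a) where

  open Fractions
  open Sums
  open Calibration
  import Data.Integer as ℤ
  open import Data.List using ([]; _∷_)
  open import Data.Rational using (ℚ; 0ℚ; 1ℚ; ½; -_; _+_; _-_; _*_; _≤_; ∣_∣; *≤*)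
  open import Data.Rational.Properties
    using (+-mono-≤; +-monoʳ-≤; +-identityʳ; +-inverseʳ; *-zeroˡ; *-identityʳ; ∣-p∣≡∣p∣; 0≤p⇒∣p∣≡p; +-0-group)
  open import Algebra.Properties.Group +-0-group using () renaming (∙-cancelˡ to +-cancelˡ)
  open import Data.Vec using (lookup)
  open import Tactic.RingSolver using (solve; solve-∀)
  open ≡-Reasoning

  n : ℕ
  n = 2 ℕ.* k

  K ε δ : ℚ
  K = fromℕ k
  ε = frac 1 (6 ℕ.* k)
  δ = frac 1 (4 ℕ.* k)

  share : Fin n → ℚ
  share i = frac (a i) (S n a)

  instance
    6k≢0 : ℕ.NonZero (6 ℕ.* k)
    6k≢0 = ℕ.m*n≢0 6 k
    4k≢0 : ℕ.NonZero (4 ℕ.* k)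
    4k≢0 = ℕ.m*n≢0 4 k
    36k≢0 : ℕ.NonZero (36 ℕ.* k)
    36k≢0 = ℕ.m*n≢0 36 k

  ε*6K≡1 : ε * (fromℕ 6 * K) ≡ 1ℚ
  ε*6K≡1 = trans (cong (ε *_) (sym (fromℕ-* 6 k))) (frac1*fromℕ≡1 (6 ℕ.* k))

  δ*4K≡1 : δ * (fromℕ 4 * K) ≡ 1ℚ
  δ*4K≡1 = trans (cong (δ *_) (sym (fromℕ-* 4 k))) (frac1*fromℕ≡1 (4 ℕ.* k))

  fromℕ-n : fromℕ n ≡ K + K
  fromℕ-n = trans (fromℕ-* 2 k) (2*x≡x+x K)
    where
    2*x≡x+x : ∀ x → fromℕ 2 * x ≡ x + x
    2*x≡x+x = solve-∀ ℚ-ring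

  sum-const : ∀ c → sumℚ n (λ _ → c) ≡ (K + K) * c
  sum-const c = trans (sumℚ-const n c) (cong (_* c) fromℕ-n)

  count-I : sumℚ n (λ i → if lookup I i then 1ℚ else 0ℚ) ≡ K
  count-I = trans (sumℚ-count I) (cong fromℕ ∣I∣≡k)

  count-∁I : sumℚ n (λ i → if not (lookup I i) then 1ℚ else 0ℚ) ≡ K
  count-∁I = +-cancelˡ K _ K (begin
    K + sumℚ n (λ i → if not (lookup I i) then 1ℚ else 0ℚ)  ≡⟨ cong₂ _+_ (sym count-I) refl ⟩
    _                                                       ≡⟨ sumℚ-partition n (lookup I) (λ _ → 1ℚ) ⟩
    sumℚ n (λ _ → 1ℚ)                                       ≡⟨ sum-const 1ℚ ⟩
    (K + K) * 1ℚ                                            ≡⟨ *-identityʳ (K + K) ⟩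
    K + K                                                   ∎)

  share-I : sumℚ n (λ i → if lookup I i then share i else 0ℚ) ≡ ½
  share-I = begin
    sumℚ n (λ i → if lookup I i then share i else 0ℚ)            ≡⟨ sumℚ-cong n (λ i → if-frac (lookup I i) (a i) (S n a)) ⟩
    sumℚ n (λ i → frac (if lookup I i then a i else 0) (S n a))  ≡⟨ sumℚ-frac n _ (S n a) ⟩
    frac (sumOn n I a) (S n a)                                   ≡⟨ frac-half (sumOn n I a) (S n a) I-halves ⟩
    ½                                                            ∎

  share-∁I : sumℚ n (λ i → if not (lookup I i) then share i else 0ℚ) ≡ ½
  share-∁I = +-cancelˡ ½ _ ½ (begin
    ½ + sumℚ n (λ i → if not (lookup I i) then share i else 0ℚ)  ≡⟨ cong₂ _+_ (sym share-I) refl ⟩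
    _                                                           ≡⟨ sumℚ-partition n (lookup I) share ⟩
    sumℚ n share                                                ≡⟨ sumℚ-frac n a (S n a) ⟩
    frac (S n a) (S n a)                                        ≡⟨ frac-self (S n a) ⟩
    1ℚ                                                          ∎)

  sum-μ-X : (b : Fin n → Bool) →
    sumℚ n (λ i → if b i then 1ℚ else 0ℚ) ≡ K → sumℚ n (λ i → if b i then share i else 0ℚ) ≡ ½ →
    sumℚ n (λ i → if b i then μ k a (X , i) else 0ℚ) ≡ ½ * K + ½
  sum-μ-X b count-b share-b = begin
    sumℚ n (λ i → if b i then ½ + share i else 0ℚ)
      ≡⟨ sumℚ-cong n (λ i → if-+ (b i) ½ (share i)) ⟩
    sumℚ n (λ i → (if b i then ½ else 0ℚ) + (if b i then share i else 0ℚ))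
      ≡⟨ sumℚ-+ n _ _ ⟩
    sumℚ n (λ i → if b i then ½ else 0ℚ) + sumℚ n (λ i → if b i then share i else 0ℚ)
      ≡⟨ cong₂ _+_ (trans (sumℚ-scale n b ½) (cong (½ *_) count-b)) share-b ⟩
    ½ * K + ½
      ∎

  high : Pt n → Bool
  high (X  , i) = lookup I i
  high (X′ , _) = false
  high (X″ , _) = true

  g : Pt n → ℚ
  g x = if high x then ½ + ε else ½

  calibratedOn-high : CalibratedOn k a high (½ + ε)
  calibratedOn-high = begin
    sumPt n (λ x → if high x then μ k a x else 0ℚ)
      ≡⟨ cong₂ _+_ (sum-μ-X (lookup I) count-I share-I) (cong₂ _+_ (sumℚ-zero n) (sum-const ½)) ⟩
    (½ * K + ½) + (0ℚ + (K + K) * ½)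
      ≡⟨ balance K ε ε*6K≡1 ⟩
    (½ + ε) * (K + (0ℚ + (K + K) * 1ℚ))
      ≡⟨ cong ((½ + ε) *_) (sym (cong₂ _+_ count-I (cong₂ _+_ (sumℚ-zero n) (sum-const 1ℚ)))) ⟩
    (½ + ε) * sumPt n (λ x → if high x then 1ℚ else 0ℚ)
      ∎
    where
    balance : ∀ K ε → ε * (fromℕ 6 * K) ≡ 1ℚ →
      (½ * K + ½) + (0ℚ + (K + K) * ½) ≡ (½ + ε) * (K + (0ℚ + (K + K) * 1ℚ))
    balance K ε ε*6K≡1 = ≡-modulo ½ ε*6K≡1 (solve (K ∷ ε ∷ []) ℚ-ring)

  calibratedOn-low : CalibratedOn k a (not ∘ high) ½
  calibratedOn-low = begin
    sumPt n (λ x → if not (high x) then μ k a x else 0ℚ)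
      ≡⟨ cong₂ _+_ (sum-μ-X (not ∘ lookup I) count-∁I share-∁I) (cong₂ _+_ (sum-const (½ - δ)) (sumℚ-zero n)) ⟩
    (½ * K + ½) + ((K + K) * (½ - δ) + 0ℚ)
      ≡⟨ balance K δ δ*4K≡1 ⟩
    ½ * (K + ((K + K) * 1ℚ + 0ℚ))
      ≡⟨ cong (½ *_) (sym (cong₂ _+_ count-∁I (cong₂ _+_ (sum-const 1ℚ) (sumℚ-zero n)))) ⟩
    ½ * sumPt n (λ x → if not (high x) then 1ℚ else 0ℚ)
      ∎
    where
    balance : ∀ K δ → δ * (fromℕ 4 * K) ≡ 1ℚ →
      (½ * K + ½) + ((K + K) * (½ - δ) + 0ℚ) ≡ ½ * (K + ((K + K) * 1ℚ + 0ℚ))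
    balance K δ δ*4K≡1 = ≡-modulo ½ δ*4K≡1 (solve (K ∷ δ ∷ []) ℚ-ring)

  ½+ε≢½ : ½ + ε ≢ ½
  ½+ε≢½ ½+ε≡½ = 1≢0 (begin
    1ℚ                  ≡⟨ sym ε*6K≡1 ⟩
    ε * (fromℕ 6 * K)   ≡⟨ cong (_* (fromℕ 6 * K)) ε≡0 ⟩
    0ℚ * (fromℕ 6 * K)  ≡⟨ *-zeroˡ (fromℕ 6 * K) ⟩
    0ℚ                  ∎)
    where
    ε≡0 : ε ≡ 0ℚ
    ε≡0 = +-cancelˡ ½ ε 0ℚ (trans ½+ε≡½ (sym (+-identityʳ ½)))
    1≢0 : 1ℚ ≢ 0ℚ
    1≢0 ()

  0≤½ : 0ℚ ≤ ½
  0≤½ = *≤* (ℤ.+≤+ ℕ.z≤n)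

  ½≤1 : ½ ≤ 1ℚ
  ½≤1 = *≤* (ℤ.+≤+ (ℕ.s≤s ℕ.z≤n))

  0≤½+ε≤1 : 0ℚ ≤ ½ + ε × ½ + ε ≤ 1ℚ
  0≤½+ε≤1 = +-mono-≤ 0≤½ (0≤frac 1 (6 ℕ.* k)) ,
            +-monoʳ-≤ ½ (frac1≤½ (ℕ.≤-trans (ℕ.s≤s (ℕ.s≤s ℕ.z≤n)) (ℕ.m≤m*n 6 k)))

  g-calibrated : PerfectlyCalibrated k a g
  g-calibrated =
    twoValued-perfectlyCalibrated k a high ½+ε≢½ 0≤½+ε≤1 (0≤½ , ½≤1) calibratedOn-high calibratedOn-low

  ∣½-g∣ : ∀ b → ∣ ½ - (if b then ½ + ε else ½) ∣ ≡ (if b then ε else 0ℚ)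
  ∣½-g∣ true  = begin
    ∣ ½ - (½ + ε) ∣  ≡⟨ cong ∣_∣ (x-[x+y]≡-y ½ ε) ⟩
    ∣ - ε ∣          ≡⟨ ∣-p∣≡∣p∣ ε ⟩
    ∣ ε ∣            ≡⟨ 0≤p⇒∣p∣≡p (0≤frac 1 (6 ℕ.* k)) ⟩
    ε                ∎
    where
    x-[x+y]≡-y : ∀ x y → x - (x + y) ≡ - y
    x-[x+y]≡-y = solve-∀ ℚ-ring
  ∣½-g∣ false = refl

  sum-∣f-g∣ : sumPt n (λ x → ∣ fPred k x - g x ∣) ≡ ε * K + (0ℚ + 0ℚ)
  sum-∣f-g∣ = cong₂ _+_
    (trans (sumℚ-cong n (λ i → ∣½-g∣ (lookup I i))) (trans (sumℚ-scale n (lookup I) ε) (cong (ε *_) count-I)))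
    (cong₂ _+_ (sumℚ-zero n) (trans (sumℚ-cong n (λ _ → cong ∣_∣ (+-inverseʳ (½ + ε)))) (sumℚ-zero n)))

  frac1[3n]≡ε : frac 1 (3 ℕ.* n) ≡ ε
  frac1[3n]≡ε = cong (frac 1) (sym (ℕ.*-assoc 3 2 k))

  dist-f-g : dist k (fPred k) g ≡ frac 1 (36 ℕ.* k)
  dist-f-g = frac1-unique (36 ℕ.* k) (begin
    dist k (fPred k) g * fromℕ (36 ℕ.* k)
      ≡⟨ cong₂ _*_ (cong₂ _*_ frac1[3n]≡ε sum-∣f-g∣) (fromℕ-* 36 k) ⟩
    ε * (ε * K + (0ℚ + 0ℚ)) * (fromℕ 36 * K)
      ≡⟨ regroup K ε ⟩
    ε * (fromℕ 6 * K) * (ε * (fromℕ 6 * K))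
      ≡⟨ cong₂ _*_ ε*6K≡1 ε*6K≡1 ⟩
    1ℚ * 1ℚ
      ∎)
    where
    regroup : ∀ K ε → ε * (ε * K + (0ℚ + 0ℚ)) * (fromℕ 36 * K) ≡ ε * (fromℕ 6 * K) * (ε * (fromℕ 6 * K))
    regroup = solve-∀ ℚ-ring

open import Data.Nat using (_*_; _+_; _≤_; _≥_; _<_; >-nonZero)
open import Data.Fin.Subset using (∣_∣)
open import Data.Product using (∃)
open Calibration using (calDistLE-witness)

lemma6p6 : (k : ℕ) → k ≥ 1 →
    (a : Fin (2 * k) → ℕ) →
    (∀ i → 0 < a i) →
    (∀ i j → (100 * k) * a i ≤ (100 * k + 1) * a j) →
    (∃ λ (I : Subset (2 * k)) → (∣ I ∣ ≡ k) × (2 * sumOn (2 * k) I a ≡ S (2 * k) a)) →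
    CalDistLE k a (frac 1 (36 * k))
lemma6p6 zero      ()
lemma6p6 k@(suc _) _ a a>0 _ (I , ∣I∣≡k , I-halves) = calDistLE-witness k a g g-calibrated dist-f-g
  where
  instance
    S≢0 : ℕ.NonZero (S (2 * k) a)
    S≢0 = >-nonZero (ℕ.<-≤-trans (a>0 zero) (ℕ.m≤m+n (a zero) _))
  open Witness k a I ∣I∣≡k I-halves
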